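{- Let $q$ be a prime and $m\ge 1$ an integer. Let $G$ be a transitive imprimitive permutation group of degree $mq$ with a complete imprimitivity block system $\mathcal{B}$, and let $H\le G$ be a subgroup having exactly $m$ orbits, each of length $q$. Let $S$ be an orbit of $H$ and let $B\in\mathcal{B}$ satisfy $B\cap S\neq\emptyset$. Then one of the following holds: (i) $|B\cap S|=1$, in which case $|B\cap S'|=1$ for every orbit $S'$ of $H$ with $B\cap S'\neq\emptyset$; or (ii) $B\cap S=S$, in which case $q$ divides $|B|$.
   Context: A complete imprimitivity block system of a transitive group $G$ acting on $V$ is a $G$-invariant partition of $V$ (the elements of $G$ permute its parts setwise) different from $\{V\}$ and from the partition into singletons. -}

module Defs where

open import Data.Nat using (ℕ; suc; _*_; _≥_)
open import Data.Nat.Divisibility using (_∣_)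
open import Data.Nat.Primality using (Prime)
open import Data.Fin using (Fin)
open import Data.Fin.Properties using (_≟_)
open import Data.Fin.Permutation using (Permutation′; _⟨$⟩ʳ_; _≈_; id; flip; _∘ₚ_)
open import Data.List using (List; length; filter; allFin)
open import Data.List.Relation.Unary.Any using (Any; any?)
open import Data.Product using (Σ; ∃; ∃-syntax; _×_; _,_)
open import Data.Sum using (_⊎_)
open import Relation.Nullary using (¬_; Dec)
open import Relation.Nullary.Decidable using (_×-dec_)
open import Relation.Binary.PropositionalEquality using (_≡_; _≢_)

-- A finite permutation group on V = Fin n, given by the (finite) list of
-- its elements; membership is up to pointwise equality of permutations.
_∈ₚ_ : ∀ {n} → Permutation′ n → List (Permutation′ n) → Set
σ ∈ₚ L = Any (λ g → g ≈ σ) L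

record IsPermGroup {n : ℕ} (G : List (Permutation′ n)) : Set where
  field
    has-id  : id ∈ₚ G
    has-inv : ∀ {g} → g ∈ₚ G → flip g ∈ₚ G
    has-mul : ∀ {g h} → g ∈ₚ G → h ∈ₚ G → (g ∘ₚ h) ∈ₚ G

IsSubgroup : ∀ {n} → List (Permutation′ n) → List (Permutation′ n) → Set
IsSubgroup H G = IsPermGroup H × (∀ {h} → h ∈ₚ H → h ∈ₚ G)

Transitive : ∀ {n} → List (Permutation′ n) → Set
Transitive {n} G = ∀ (x y : Fin n) → ∃[ g ] (g ∈ₚ G × g ⟨$⟩ʳ x ≡ y)

-- A partition of Fin n is given as the kernel of a labelling function β:
-- the parts are the nonempty fibres {y | β y ≡ β x}.
Block : ∀ {n} → (Fin n → Fin n) → Fin n → Fin n → Set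
Block β x y = β y ≡ β x

-- complete imprimitivity block system: G-invariant partition, ≠ {V},
-- ≠ partition into singletons
IsCompleteBlockSystem : ∀ {n} → List (Permutation′ n) → (Fin n → Fin n) → Set
IsCompleteBlockSystem {n} G β =
  (∀ g → g ∈ₚ G → ∀ (x y : Fin n) → β x ≡ β y → β (g ⟨$⟩ʳ x) ≡ β (g ⟨$⟩ʳ y))
  × (∃[ x ] ∃[ y ] (β x ≢ β y))
  × (∃[ x ] ∃[ y ] (x ≢ y × β x ≡ β y))

Orbit : ∀ {n} → List (Permutation′ n) → Fin n → Fin n → Set
Orbit H x y = Any (λ h → h ⟨$⟩ʳ x ≡ y) H

orbit? : ∀ {n} (H : List (Permutation′ n)) (x y : Fin n) → Dec (Orbit H x y)
orbit? H x y = any? (λ h → h ⟨$⟩ʳ x ≟ y) H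

block? : ∀ {n} (β : Fin n → Fin n) (x y : Fin n) → Dec (Block β x y)
block? β x y = β y ≟ β x

count : ∀ {n} {P : Fin n → Set} → ((y : Fin n) → Dec (P y)) → ℕ
count {n} P? = length (filter P? (allFin n))

∩? : ∀ {n} {P Q : Fin n → Set} → ((y : Fin n) → Dec (P y)) → ((y : Fin n) → Dec (Q y))
     → (y : Fin n) → Dec (P y × Q y)
∩? P? Q? y = P? y ×-dec Q? y

-- H has exactly m orbits, each of length q: there are representatives
-- r : Fin m → V lying in pairwise distinct orbits, every point lies in the
-- orbit of some representative, and every orbit has exactly q points.
HasOrbitsOfLength : ∀ {n} → List (Permutation′ n) → ℕ → ℕ → Set
HasOrbitsOfLength {n} H m q =
  (Σ (Fin m → Fin n) λ r →
      (∀ i j → Orbit H (r i) (r j) → i ≡ j)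
    × (∀ (y : Fin n) → ∃[ i ] Orbit H (r i) y))
  × (∀ (x : Fin n) → count (orbit? H x) ≡ q)

-- The blocks meeting an H-orbit S cut it into pieces which H permutes
-- transitively, because H preserves the partition; so all pieces have the same
-- size, which divides |S| = q and is therefore 1 or q.  In the second case
-- S ⊆ B, so B is H-invariant and hence a union of H-orbits of size q.  A block
-- containing one H-orbit contains every H-orbit it meets, which keeps the two
-- cases apart.
module Submission where

open import Defs
open import Level using (0ℓ)
open import Function using (_∘_)
open import Data.Nat using (ℕ; zero; suc; _+_; _*_; _≥_; _<_)
open import Data.Nat.Properties
  using (+-0-commutativeMonoid; +-cancelˡ-≡; +-identityʳ; m<n+m; n≮n)
open import Data.Nat.Induction using (<-wellFounded)
open import Data.Nat.Divisibility using (_∣_; ∣-refl; ∣m∣n⇒∣m+n; _∣0)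
open import Data.Nat.Primality using (Prime; prime⇒irreducible; ¬prime[1])
open import Data.Fin using (Fin; zero; suc)
open import Data.Fin.Permutation
  using (Permutation′; _⟨$⟩ʳ_; id; flip; _∘ₚ_; inverseˡ)
open import Data.List using (List; []; _∷_; length; filter; allFin; tabulate)
open import Data.List.Relation.Unary.Any as Any using (Any; here)
open import Data.List.Membership.Propositional using (_∈_; find)
open import Data.List.Membership.Propositional.Properties
  using (∈-filter⁺; ∈-filter⁻; ∈-allFin; ∈-length)
open import Data.Product using (∃; ∃-syntax; _×_; _,_; proj₁; proj₂)
open import Data.Sum as Sum using (_⊎_; inj₁; inj₂; fromInj₁)
open import Data.Empty using (⊥-elim)
open import Induction.WellFounded using (Acc; acc)
open import Relation.Nullary using (Dec; yes; no; contradiction)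
open import Relation.Unary using (Pred; Decidable; _⊆_; _∩_; ∁)
open import Relation.Unary.Properties using (∁?)
open import Relation.Binary.PropositionalEquality
  using (_≡_; _≢_; refl; sym; trans; cong; cong₂; subst; subst₂; module ≡-Reasoning)
open import Algebra.Properties.CommutativeMonoid.Sum +-0-commutativeMonoid
  using (sum; sum-cong-≗; sum-permute; ∑-distrib-+)

private
  variable
    n : ℕ
    P Q : Pred (Fin n) 0ℓ

indicator : {A : Set} → Dec A → ℕ
indicator (yes _) = 1
indicator (no _)  = 0

length-filter-tabulate : ∀ {k} (P? : Decidable P) (f : Fin k → Fin n) →
  length (filter P? (tabulate f)) ≡ sum (indicator ∘ P? ∘ f)
length-filter-tabulate {k = zero}  P? f = refl
length-filter-tabulate {k = suc k} P? f with P? (f zero)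
... | yes _ = cong suc (length-filter-tabulate P? (f ∘ suc))
... | no _  = length-filter-tabulate P? (f ∘ suc)

count≡sum : (P? : Decidable P) → count P? ≡ sum (indicator ∘ P?)
count≡sum P? = length-filter-tabulate P? (λ y → y)

count>0 : (P? : Decidable P) {y : Fin n} → P y → 0 < count P?
count>0 P? {y} p = ∈-length (∈-filter⁺ P? (∈-allFin y) p)

count≡0⊎∃ : (P? : Decidable P) → count P? ≡ 0 ⊎ ∃ P
count≡0⊎∃ P? with filter P? (allFin _) in eq
... | []    = inj₁ refl
... | y ∷ _ = inj₂ (y , proj₂ (∈-filter⁻ P? {xs = allFin _} (subst (y ∈_) (sym eq) (here refl))))

count-cong : (P? : Decidable P) (Q? : Decidable Q) → P ⊆ Q → Q ⊆ P →
  count P? ≡ count Q?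
count-cong P? Q? P⊆Q Q⊆P = begin
  count P?                 ≡⟨ count≡sum P? ⟩
  sum (indicator ∘ P?)     ≡⟨ sum-cong-≗ pointwise ⟩
  sum (indicator ∘ Q?)     ≡⟨ count≡sum Q? ⟨
  count Q?                 ∎
  where
  open ≡-Reasoning
  pointwise : ∀ y → indicator (P? y) ≡ indicator (Q? y)
  pointwise y with P? y | Q? y
  ... | yes _ | yes _ = refl
  ... | no  _ | no  _ = refl
  ... | yes p | no ¬q = contradiction (P⊆Q p) ¬q
  ... | no ¬p | yes q = contradiction (Q⊆P q) ¬p

count-split : (P? : Decidable P) (Q? : Decidable Q) →
  count Q? ≡ count (∩? P? Q?) + count (∩? (∁? P?) Q?)
count-split {P = P} {Q = Q} P? Q? = begin
  count Q?                                   ≡⟨ count≡sum Q? ⟩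
  sum (indicator ∘ Q?)                       ≡⟨ sum-cong-≗ pointwise ⟩
  sum (λ y → indicator (in? y) + indicator (out? y))
                                             ≡⟨ ∑-distrib-+ (indicator ∘ in?) (indicator ∘ out?) ⟩
  sum (indicator ∘ in?) + sum (indicator ∘ out?)
                                             ≡⟨ cong₂ _+_ (count≡sum in?) (count≡sum out?) ⟨
  count in? + count out?                     ∎
  where
  open ≡-Reasoning
  in? : Decidable (P ∩ Q)
  in? = ∩? P? Q?
  out? : Decidable (∁ P ∩ Q)
  out? = ∩? (∁? P?) Q?
  pointwise : ∀ y → indicator (Q? y) ≡ indicator (in? y) + indicator (out? y)
  pointwise y with P? y | Q? y
  ... | yes _ | yes _ = refl
  ... | yes _ | no  _ = refl
  ... | no  _ | yes _ = refl
  ... | no  _ | no  _ = refl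

count-permute : (P? : Decidable P) (σ : Permutation′ n) →
  count P? ≡ count (P? ∘ (σ ⟨$⟩ʳ_))
count-permute P? σ =
  trans (count≡sum P?) (trans (sum-permute _ σ) (sym (count≡sum (P? ∘ (σ ⟨$⟩ʳ_)))))

⊆⇒count-∩≡count : (P? : Decidable P) (Q? : Decidable Q) → Q ⊆ P →
  count (∩? P? Q?) ≡ count Q?
⊆⇒count-∩≡count P? Q? Q⊆P = count-cong (∩? P? Q?) Q? proj₂ (λ q → Q⊆P q , q)

count-∩≡count⇒⊆ : (P? : Decidable P) (Q? : Decidable Q) →
  count (∩? P? Q?) ≡ count Q? → Q ⊆ P
count-∩≡count⇒⊆ {P = P} {Q = Q} P? Q? eq {y} q with P? y
... | yes p = p
... | no ¬p = contradiction (subst (0 <_) nothing-outside (count>0 outside? (¬p , q))) (n≮n 0)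
  where
  outside? : Decidable (∁ P ∩ Q)
  outside? = ∩? (∁? P?) Q?
  nothing-outside : count outside? ≡ 0
  nothing-outside = +-cancelˡ-≡ (count Q?) _ _ (begin
    count Q? + count outside?         ≡⟨ cong (_+ count outside?) eq ⟨
    count (∩? P? Q?) + count outside? ≡⟨ count-split P? Q? ⟨
    count Q?                          ≡⟨ +-identityʳ (count Q?) ⟨
    count Q? + 0                      ∎)
    where open ≡-Reasoning

module _ {E : Fin n → Fin n → Set} (E? : ∀ y z → Dec (E y z))
         (E-refl : ∀ {y} → E y y) (E-sym : ∀ {y z} → E y z → E z y)
         (E-trans : ∀ {x y z} → E x y → E y z → E x z) (k : ℕ) where

  ∣-count-of-equinumerous-classes : (P? : Decidable P) →
    (∀ {y} → P y → count (∩? (E? y) P?) ≡ k) → k ∣ count P?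
  ∣-count-of-equinumerous-classes P? classes = go P? classes (<-wellFounded _)
    where
    go : ∀ {P} (P? : Decidable P) → (∀ {y} → P y → count (∩? (E? y) P?) ≡ k) →
         Acc _<_ (count P?) → k ∣ count P?
    go {P} P? classes (acc rec) with count≡0⊎∃ P?
    ... | inj₁ c≡0 = subst (k ∣_) (sym c≡0) (k ∣0)
    ... | inj₂ (y , py) =
      subst (k ∣_) (sym split) (∣m∣n⇒∣m+n ∣-refl (go rest? rest-classes (rec shrinks)))
      where
      rest? : Decidable (∁ (E y) ∩ P)
      rest? = ∩? (∁? (E? y)) P?
      split : count P? ≡ k + count rest?
      split = trans (count-split (E? y) P?) (cong (_+ count rest?) (classes py))
      shrinks : count rest? < count P?
      shrinks = subst (count rest? <_) (sym split)
        (m<n+m _ (subst (0 <_) (classes py) (count>0 (∩? (E? y) P?) (E-refl , py))))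
      rest-classes : ∀ {y′} → (∁ (E y) ∩ P) y′ → count (∩? (E? y′) rest?) ≡ k
      rest-classes {y′} (¬yy′ , py′) = trans
        (count-cong (∩? (E? y′) rest?) (∩? (E? y′) P?) (λ (e , _ , p) → e , p)
          (λ (e , p) → e , (λ e′ → ¬yy′ (E-trans e′ (E-sym e))) , p))
        (classes py′)

find-∈ₚ : ∀ {B : Permutation′ n → Set} (G : List (Permutation′ n)) →
  Any B G → ∃[ g ] (g ∈ₚ G × B g)
find-∈ₚ G a with find a
... | g , g∈G , b = g , Any.map (λ { refl _ → refl }) g∈G , b

module OrbitsOfGroup (H : List (Permutation′ n)) (isGroup : IsPermGroup H) where
  open IsPermGroup isGroup

  ∈ₚ⇒orbit : ∀ h → h ∈ₚ H → ∀ y → Orbit H y (h ⟨$⟩ʳ y)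
  ∈ₚ⇒orbit h h∈H y = Any.map (λ g≈h → g≈h y) h∈H

  orbit-refl : ∀ {y} → Orbit H y y
  orbit-refl {y} = ∈ₚ⇒orbit id has-id y

  orbit-sym : ∀ {y z} → Orbit H y z → Orbit H z y
  orbit-sym o with find-∈ₚ H o
  ... | h , h∈H , refl = subst (Orbit H _) (inverseˡ h) (∈ₚ⇒orbit (flip h) (has-inv {h} h∈H) _)

  orbit-trans : ∀ {x y z} → Orbit H x y → Orbit H y z → Orbit H x z
  orbit-trans o o′ with find-∈ₚ H o | find-∈ₚ H o′
  ... | g , g∈H , refl | h , h∈H , refl = ∈ₚ⇒orbit (g ∘ₚ h) (has-mul {g} {h} g∈H h∈H) _

module BlocksAndOrbits (H : List (Permutation′ n)) (isGroup : IsPermGroup H)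
    (β : Fin n → Fin n)
    (preserves : ∀ h → h ∈ₚ H → ∀ {y z} → β y ≡ β z → β (h ⟨$⟩ʳ y) ≡ β (h ⟨$⟩ʳ z))
    where
  open IsPermGroup isGroup
  open OrbitsOfGroup H isGroup

  block∩orbit : Fin n → Fin n → ℕ
  block∩orbit b x = count (∩? (block? β b) (orbit? H x))

  reflects : ∀ h → h ∈ₚ H → ∀ {y z} → β (h ⟨$⟩ʳ y) ≡ β (h ⟨$⟩ʳ z) → β y ≡ β z
  reflects h h∈H e =
    subst₂ (λ y z → β y ≡ β z) (inverseˡ h) (inverseˡ h) (preserves (flip h) (has-inv {h} h∈H) e)

  block∩orbit-translate : ∀ h → h ∈ₚ H → ∀ y x →
    block∩orbit (h ⟨$⟩ʳ y) x ≡ block∩orbit y x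
  block∩orbit-translate h h∈H y x =
    trans (count-permute (∩? (block? β (h ⟨$⟩ʳ y)) (orbit? H x)) h)
          (count-cong _ (∩? (block? β y) (orbit? H x))
      (λ {z} (e , o) → reflects h h∈H e , orbit-trans o (orbit-sym (∈ₚ⇒orbit h h∈H z)))
      (λ {z} (e , o) → preserves h h∈H e , orbit-trans o (∈ₚ⇒orbit h h∈H z)))

  block∩orbit-cong : ∀ {b w} → Block β b w → ∀ x → block∩orbit w x ≡ block∩orbit b x
  block∩orbit-cong b~w x =
    count-cong (∩? (block? β _) (orbit? H x)) (∩? (block? β _) (orbit? H x))
    (λ (e , o) → trans e b~w , o) (λ (e , o) → trans e (sym b~w) , o)

  block∩orbit-constant : ∀ {b w x y} → Block β b w → Orbit H x w → Orbit H x y →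
    block∩orbit y x ≡ block∩orbit b x
  block∩orbit-constant {w = w} {x} b~w x~w x~y
    with find-∈ₚ H (orbit-trans (orbit-sym x~w) x~y)
  ... | h , h∈H , refl = trans (block∩orbit-translate h h∈H w x) (block∩orbit-cong b~w x)

  block∩orbit-∣-orbit : ∀ {b w x} → Block β b w → Orbit H x w →
    block∩orbit b x ∣ count (orbit? H x)
  block∩orbit-∣-orbit b~w x~w =
    ∣-count-of-equinumerous-classes (block? β) refl sym (λ e e′ → trans e′ e) _ (orbit? H _)
      (block∩orbit-constant b~w x~w)

  orbit⊆block⇒meeting-orbit⊆block : ∀ {b x y w} → Orbit H x ⊆ Block β b →
    Block β b w → Orbit H y w → Orbit H y ⊆ Block β b
  orbit⊆block⇒meeting-orbit⊆block {x = x} x⊆B b~w y~w y~z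
    with find-∈ₚ H (orbit-trans (orbit-sym y~w) y~z)
  ... | h , h∈H , refl =
    trans (preserves h h∈H (trans b~w (sym (x⊆B orbit-refl)))) (x⊆B (∈ₚ⇒orbit h h∈H x))

  orbit-size-∣-block : ∀ {q b x} → (∀ y → count (orbit? H y) ≡ q) → Orbit H x ⊆ Block β b →
    q ∣ count (block? β b)
  orbit-size-∣-block {q} orbit-size x⊆B =
    ∣-count-of-equinumerous-classes (orbit? H) orbit-refl orbit-sym orbit-trans q (block? β _)
      (λ {y} b~y → trans (count-cong (∩? (orbit? H y) (block? β _)) (orbit? H y) proj₁
        (λ y~z → y~z , orbit⊆block⇒meeting-orbit⊆block x⊆B b~y orbit-refl y~z)) (orbit-size y))

lemma2p1 : (q m : ℕ) → Prime q → m ≥ 1 →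
    (G H : List (Permutation′ (m * q))) →
    IsPermGroup G → Transitive G →
    (β : Fin (m * q) → Fin (m * q)) → IsCompleteBlockSystem G β →
    IsSubgroup H G → HasOrbitsOfLength H m q →
    (x b : Fin (m * q)) →
    (∃[ w ] (Block β b w × Orbit H x w)) →
    ((count (∩? (block? β b) (orbit? H x)) ≡ 1)
    × (∀ (x′ : Fin (m * q)) → (∃[ w ] (Block β b w × Orbit H x′ w)) →
    count (∩? (block? β b) (orbit? H x′)) ≡ 1))
    ⊎ ((∀ (y : Fin (m * q)) → Orbit H x y → Block β b y)
    × (q ∣ count (block? β b)))
lemma2p1 q m q-prime _ G H _ _ β bs (isGroup , H⊆G) (_ , orbit-size) x b (w , b~w , x~w) =
  Sum.map singleton whole (one-or-all b~w x~w)
  where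
  open BlocksAndOrbits H isGroup β (λ h h∈H {y} {z} → proj₁ bs h (H⊆G {h} h∈H) y z)

  one-or-all : ∀ {x w} → Block β b w → Orbit H x w →
    block∩orbit b x ≡ 1 ⊎ block∩orbit b x ≡ q
  one-or-all b~w x~w = prime⇒irreducible q-prime
    (subst (block∩orbit b _ ∣_) (orbit-size _) (block∩orbit-∣-orbit b~w x~w))

  orbit⊆block : ∀ {x} → block∩orbit b x ≡ q → Orbit H x ⊆ Block β b
  orbit⊆block {x} all =
    count-∩≡count⇒⊆ (block? β b) (orbit? H x) (trans all (sym (orbit-size x)))

  whole : block∩orbit b x ≡ q → (∀ y → Orbit H x y → Block β b y) × q ∣ count (block? β b)
  whole all = (λ _ → orbit⊆block all) , orbit-size-∣-block orbit-size (orbit⊆block all)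

  no-orbit-inside : block∩orbit b x ≡ 1 →
    ∀ {x′ w′} → Block β b w′ → Orbit H x′ w′ → block∩orbit b x′ ≢ q
  no-orbit-inside one b~w′ x′~w′ all′ = ¬prime[1] (subst Prime (sym 1≡q) q-prime)
    where
    1≡q : 1 ≡ q
    1≡q = trans (sym one) (trans (⊆⇒count-∩≡count (block? β b) (orbit? H x)
      (orbit⊆block⇒meeting-orbit⊆block (orbit⊆block all′) b~w x~w)) (orbit-size x))

  singleton : block∩orbit b x ≡ 1 →
    block∩orbit b x ≡ 1 ×
    (∀ x′ → ∃[ w ] (Block β b w × Orbit H x′ w) → block∩orbit b x′ ≡ 1)
  singleton one = one , λ x′ (w′ , b~w′ , x′~w′) →
    fromInj₁ (⊥-elim ∘ no-orbit-inside one b~w′ x′~w′) (one-or-all b~w′ x′~w′)
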